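{- Let $\mathbb N_B\subseteq\mathbb N$ be fixed, let $(q_n)_{n\ge1}$ be a fixed sequence of integers with $q_n>1$ for all $n$, and set $a_n=-1$ if $n\in\mathbb N_B$ and $a_n=1$ if $n\notin\mathbb N_B$. For a digit sequence $(\delta_k)$ with $\delta_k\in\{0,\dots,q_k-1\}$ write $\Delta_{\delta_1\delta_2\dots}=\sum_{k\ge1}\frac{a_k\delta_k}{q_1\cdots q_k}$. Let $x=\Delta_{\varepsilon_1\varepsilon_2\dots\varepsilon_k\dots}$. Then $x$ is rational if and only if there exist $n\in\mathbb Z_0=\mathbb N\cup\{0\}$ and $m\in\mathbb N$ such that $$\Delta_{\underbrace{0\ldots0}_{n}\varepsilon_{n+1}\varepsilon_{n+2}\ldots}=q_{n+1}\cdots q_{n+m}\,\Delta_{\underbrace{0\ldots0}_{n+m}\varepsilon_{n+m+1}\varepsilon_{n+m+2}\ldots},$$ i.e. $\sum_{k>n}\frac{a_k\varepsilon_k}{q_1\cdots q_k}=q_{n+1}\cdots q_{n+m}\sum_{k>n+m}\frac{a_k\varepsilon_k}{q_1\cdots q_k}$.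
   Context: Here $\Delta_{\underbrace{0\ldots0}_{n}\varepsilon_{n+1}\ldots}$ denotes the value of the sign-variable Cantor series whose first $n$ digits are $0$ and whose $k$-th digit for $k>n$ is $\varepsilon_k$. -}

module Defs where

open import Data.Bool using (Bool; true; false)
open import Data.Nat as ℕ using (ℕ; zero; suc; _≤ᵇ_)
open import Data.Integer as ℤ using (ℤ; +_)
open import Data.Rational as ℚ using (ℚ; 0ℚ; _/_; _+_; _-_; _*_; ∣_∣; _<_)
open import Data.Product using (∃; Σ; _×_)

sign : (ℕ → Bool) → ℕ → ℤ
sign inB k with inB k
... | true  = ℤ.-[1+ 0 ]
... | false = + 1

-- q₁ ⋯ qₖ  (q₀ is ignored; indices start at 1)
Q : (ℕ → ℕ) → ℕ → ℕ
Q q zero    = 1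
Q q (suc k) = Q q k ℕ.* q (suc k)

blockProd : (ℕ → ℕ) → ℕ → ℕ → ℕ
blockProd q n zero    = 1
blockProd q n (suc m) = blockProd q n m ℕ.* q (n ℕ.+ suc m)

-- z / d, with the (never used, since q_k > 1) convention z / 0 = 0
safeDiv : ℤ → ℕ → ℚ
safeDiv z zero    = 0ℚ
safeDiv z (suc d) = z / suc d

term : (ℕ → Bool) → (ℕ → ℕ) → (ℕ → ℕ) → ℕ → ℚ
term inB q δ k = safeDiv (sign inB k ℤ.* (+ δ k)) (Q q k)

partialΔ : (ℕ → Bool) → (ℕ → ℕ) → (ℕ → ℕ) → ℕ → ℚ
partialΔ inB q δ zero    = 0ℚ
partialΔ inB q δ (suc N) = partialΔ inB q δ N + term inB q δ (suc N)

zeroFirst : ℕ → (ℕ → ℕ) → ℕ → ℕ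
zeroFirst n δ k with k ≤ᵇ n
... | true  = 0
... | false = δ k

ConvergesTo : (ℕ → ℚ) → ℚ → Set
ConvergesTo s r = ∀ (e : ℚ) → 0ℚ < e → ∃ λ N → ∀ k → N ℕ.≤ k → ∣ s k - r ∣ < e

ΔRational : (ℕ → Bool) → (ℕ → ℕ) → (ℕ → ℕ) → Set
ΔRational inB q δ = ∃ λ (r : ℚ) → ConvergesTo (partialΔ inB q δ) r

-- Δ_{δ} = c · Δ_{γ}  (equality of the real sums of the two convergent series)
ΔEqScaled : (ℕ → Bool) → (ℕ → ℕ) → (ℕ → ℕ) → ℚ → (ℕ → ℕ) → Set
ΔEqScaled inB q δ c γ =
  ConvergesTo (λ N → partialΔ inB q δ N - c * partialΔ inB q γ N) 0ℚ

module Submission where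

-- Write Sₖ for the k-th partial sum, r for a rational limit of it, and d for the denominator of r. Since
-- Qₖ Sₖ is an integer, so is d Qₖ (r - Sₖ); and since |Sₖ' - Sₖ| < 1/Qₖ for all k' ≥ k (the digits
-- satisfy εᵢ ≤ qᵢ - 1, so the tail telescopes), this integer lies in [-d, d]. By the pigeonhole principle
-- it takes the same value at some n and n + m, i.e. r - Sₙ = qₙ₊₁⋯qₙ₊ₘ (r - Sₙ₊ₘ), which is the claimed
-- relation between the two tails. Conversely, that relation with B = qₙ₊₁⋯qₙ₊ₘ ≥ 2 says that
-- (1 - B) Sₖ - (Sₙ - B Sₙ₊ₘ) tends to 0, so Sₖ tends to the rational (Sₙ - B Sₙ₊ₘ) / (1 - B).

open import Defs
open import Data.Bool using (Bool; true; false; T)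
open import Data.Empty using (⊥-elim)
import Data.Fin as Fin
import Data.Fin.Properties as FinP
open import Data.Integer as ℤ using (ℤ; +_; -[1+_])
import Data.Integer.Properties as ℤP
open import Data.Integer.Solver using (module +-*-Solver)
open import Data.Nat as ℕ using (ℕ; zero; suc)
import Data.Nat.Properties as ℕP
open import Data.Product using (∃; ∃₂; _×_; _,_; map₂)
open import Data.Rational
  using ( ℚ; 0ℚ; 1ℚ; _/_; _+_; _-_; _*_; -_; 1/_; ∣_∣; _<_; _≤_; ↥_; ↧ₙ_; toℚᵘ
        ; NonNegative; Positive; NonZero; positive; ≢-nonZero )
open import Data.Rational.Properties
import Data.Rational.Solver
import Data.Rational.Unnormalised as ℚᵘ
import Data.Rational.Unnormalised.Properties as ℚᵘP
open import Function.Bundles using (_⇔_; mk⇔)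
open import Relation.Binary.PropositionalEquality

private
  module ℚ-Solver = Data.Rational.Solver.+-*-Solver

fromℤ : ℤ → ℚ
fromℤ z = z / 1

fromℕ : ℕ → ℚ
fromℕ n = fromℤ (+ n)

private
  toℚᵘ-fromℤ : ∀ z → toℚᵘ (fromℤ z) ℚᵘ.≃ ℚᵘ.mkℚᵘ z 0
  toℚᵘ-fromℤ z = toℚᵘ-fromℚᵘ (ℚᵘ.mkℚᵘ z 0)

  fromℤ-≃ : ∀ z {p} → ℚᵘ.mkℚᵘ z 0 ℚᵘ.≃ toℚᵘ p → fromℤ z ≡ p
  fromℤ-≃ z eq = toℚᵘ-injective (ℚᵘP.≃-trans (toℚᵘ-fromℤ z) eq)

fromℤ-+ : ∀ a b → fromℤ (a ℤ.+ b) ≡ fromℤ a + fromℤ b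
fromℤ-+ a b = fromℤ-≃ (a ℤ.+ b) (ℚᵘP.≃-trans (ℚᵘ.*≡* integral) (ℚᵘP.≃-sym
  (ℚᵘP.≃-trans (toℚᵘ-homo-+ (fromℤ a) (fromℤ b)) (ℚᵘP.+-cong (toℚᵘ-fromℤ a) (toℚᵘ-fromℤ b)))))
  where
  open +-*-Solver
  integral : (a ℤ.+ b) ℤ.* + 1 ≡ (a ℤ.* + 1 ℤ.+ b ℤ.* + 1) ℤ.* + 1
  integral = solve 2 (λ a b → (a :+ b) :* con (+ 1) := (a :* con (+ 1) :+ b :* con (+ 1)) :* con (+ 1)) refl a b

fromℤ-* : ∀ a b → fromℤ (a ℤ.* b) ≡ fromℤ a * fromℤ b
fromℤ-* a b = fromℤ-≃ (a ℤ.* b) (ℚᵘP.≃-sym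
  (ℚᵘP.≃-trans (toℚᵘ-homo-* (fromℤ a) (fromℤ b)) (ℚᵘP.*-cong (toℚᵘ-fromℤ a) (toℚᵘ-fromℤ b))))

fromℤ-neg : ∀ a → fromℤ (ℤ.- a) ≡ - fromℤ a
fromℤ-neg a = fromℤ-≃ (ℤ.- a) (ℚᵘP.≃-sym
  (ℚᵘP.≃-trans (toℚᵘ-homo‿- (fromℤ a)) (ℚᵘP.-‿cong (toℚᵘ-fromℤ a))))

fromℤ-- : ∀ a b → fromℤ (a ℤ.- b) ≡ fromℤ a - fromℤ b
fromℤ-- a b = trans (fromℤ-+ a (ℤ.- b)) (cong (λ x → fromℤ a + x) (fromℤ-neg b))

fromℤ-∣-∣ : ∀ a → ∣ fromℤ a ∣ ≡ fromℕ ℤ.∣ a ∣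
fromℤ-∣-∣ a = sym (fromℤ-≃ (+ ℤ.∣ a ∣) (ℚᵘP.≃-sym
  (ℚᵘP.≃-trans (toℚᵘ-homo-∣-∣ (fromℤ a)) (ℚᵘP.∣-∣-cong (toℚᵘ-fromℤ a)))))

fromℤ-mono-< : ∀ {a b} → a ℤ.< b → fromℤ a < fromℤ b
fromℤ-mono-< {a} {b} a<b = toℚᵘ-cancel-<
  (ℚᵘP.<-respʳ-≃ (ℚᵘP.≃-sym (toℚᵘ-fromℤ b)) (ℚᵘP.<-respˡ-≃ (ℚᵘP.≃-sym (toℚᵘ-fromℤ a))
    (ℚᵘ.*<* (subst₂ ℤ._<_ (sym (ℤP.*-identityʳ a)) (sym (ℤP.*-identityʳ b)) a<b))))

fromℤ-cancel-< : ∀ {a b} → fromℤ a < fromℤ b → a ℤ.< b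
fromℤ-cancel-< {a} {b} lt
  with ℚᵘ.*<* a<b ← ℚᵘP.<-respʳ-≃ (toℚᵘ-fromℤ b) (ℚᵘP.<-respˡ-≃ (toℚᵘ-fromℤ a) (toℚᵘ-mono-< lt))
  = subst₂ ℤ._<_ (ℤP.*-identityʳ a) (ℤP.*-identityʳ b) a<b

fromℕ-+ : ∀ m n → fromℕ (m ℕ.+ n) ≡ fromℕ m + fromℕ n
fromℕ-+ m n = trans (cong fromℤ (ℤP.pos-+ m n)) (fromℤ-+ (+ m) (+ n))

fromℕ-* : ∀ m n → fromℕ (m ℕ.* n) ≡ fromℕ m * fromℕ n
fromℕ-* m n = trans (cong fromℤ (ℤP.pos-* m n)) (fromℤ-* (+ m) (+ n))

fromℕ-nonNeg : ∀ n → NonNegative (fromℕ n)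
fromℕ-nonNeg n = normalize-nonNeg n 1

fromℕ-pos : ∀ {n} → 1 ℕ.≤ n → Positive (fromℕ n)
fromℕ-pos {suc n} _ = normalize-pos (suc n) 1

/-*-fromℕ : ∀ z n → (z / suc n) * fromℕ (suc n) ≡ fromℤ z
/-*-fromℕ z n = toℚᵘ-injective (ℚᵘP.≃-trans (toℚᵘ-homo-* (z / suc n) (fromℕ (suc n)))
  (ℚᵘP.≃-trans (ℚᵘP.*-cong (toℚᵘ-fromℚᵘ (ℚᵘ.mkℚᵘ z n)) (toℚᵘ-fromℤ (+ suc n)))
    (ℚᵘP.≃-trans (ℚᵘ.*≡* integral) (ℚᵘP.≃-sym (toℚᵘ-fromℤ z)))))
  where
  integral : z ℤ.* + suc n ℤ.* + 1 ≡ z ℤ.* + (suc n ℕ.* 1)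
  integral = trans (ℤP.*-identityʳ (z ℤ.* + suc n)) (cong (λ k → z ℤ.* + k) (sym (ℕP.*-identityʳ (suc n))))

safeDiv-*-fromℕ : ∀ z {n} → 1 ℕ.≤ n → safeDiv z n * fromℕ n ≡ fromℤ z
safeDiv-*-fromℕ z {suc n} _ = /-*-fromℕ z n

∣-∣-*-fromℕ : ∀ x n → ∣ x * fromℕ n ∣ ≡ ∣ x ∣ * fromℕ n
∣-∣-*-fromℕ x n = trans (∣p*q∣≡∣p∣*∣q∣ x (fromℕ n)) (cong (∣ x ∣ *_) (fromℤ-∣-∣ (+ n)))

*-cancelʳ-≡-pos : ∀ {p q} r .{{_ : Positive r}} → p * r ≡ q * r → p ≡ q
*-cancelʳ-≡-pos r eq = ≤-antisym (*-cancelʳ-≤-pos r (≤-reflexive eq)) (*-cancelʳ-≤-pos r (≤-reflexive (sym eq)))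

ConvergesTo-*-bound : ∀ {s r} → ConvergesTo s r → ∀ c .{{_ : NonNegative c}} →
                      ∀ e → 0ℚ < e → ∃ λ N → ∀ k → N ℕ.≤ k → ∣ s k - r ∣ * c < e
ConvergesTo-*-bound {s} {r} conv c e e>0 = within (conv (e * 1/ (c + 1ℚ)) e/[c+1]>0)
  where
  open ≤-Reasoning
  instance
    c+1-pos : Positive (c + 1ℚ)
    c+1-pos = nonNeg+pos⇒pos c 1ℚ
    c+1-nonZero : NonZero (c + 1ℚ)
    c+1-nonZero = pos⇒nonZero (c + 1ℚ)
  e/[c+1]>0 : 0ℚ < e * 1/ (c + 1ℚ)
  e/[c+1]>0 = positive⁻¹ _ {{pos*pos⇒pos e {{positive e>0}} (1/ (c + 1ℚ)) {{1/pos⇒pos (c + 1ℚ)}}}}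
  c≤c+1 : c ≤ c + 1ℚ
  c≤c+1 = ≤-trans (≤-reflexive (sym (+-identityʳ c))) (+-monoʳ-≤ c (nonNegative⁻¹ 1ℚ))
  within : (∃ λ N → ∀ k → N ℕ.≤ k → ∣ s k - r ∣ < e * 1/ (c + 1ℚ)) →
           ∃ λ N → ∀ k → N ℕ.≤ k → ∣ s k - r ∣ * c < e
  within (N , close) = N , λ k N≤k → begin-strict
    ∣ s k - r ∣ * c               ≤⟨ *-monoˡ-≤-nonNeg ∣ s k - r ∣ {{∣-∣-nonNeg (s k - r)}} c≤c+1 ⟩
    ∣ s k - r ∣ * (c + 1ℚ)        <⟨ *-monoˡ-<-pos (c + 1ℚ) (close k N≤k) ⟩
    e * 1/ (c + 1ℚ) * (c + 1ℚ)    ≡⟨ *-assoc e _ _ ⟩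
    e * (1/ (c + 1ℚ) * (c + 1ℚ))  ≡⟨ cong (e *_) (*-inverseˡ (c + 1ℚ)) ⟩
    e * 1ℚ                        ≡⟨ *-identityʳ e ⟩
    e                             ∎

ConvergesTo-rescale : ∀ s r t u c → (∃ λ N → ∀ k → N ℕ.≤ k → t k - u ≡ c * (s k - r)) →
                      ConvergesTo s r → ConvergesTo t u
ConvergesTo-rescale s r t u c (N , related) conv e e>0
  with M , close ← ConvergesTo-*-bound {s} {r} conv ∣ c ∣ {{∣-∣-nonNeg c}} e e>0
  = N ℕ.⊔ M , λ k N⊔M≤k → begin-strict
      ∣ t k - u ∣          ≡⟨ cong ∣_∣ (related k (ℕP.≤-trans (ℕP.m≤m⊔n N M) N⊔M≤k)) ⟩
      ∣ c * (s k - r) ∣    ≡⟨ ∣p*q∣≡∣p∣*∣q∣ c (s k - r) ⟩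
      ∣ c ∣ * ∣ s k - r ∣  ≡⟨ *-comm ∣ c ∣ _ ⟩
      ∣ s k - r ∣ * ∣ c ∣  <⟨ close k (ℕP.≤-trans (ℕP.m≤n⊔m N M) N⊔M≤k) ⟩
      e                    ∎
  where open ≤-Reasoning

bounded⇒repeats : (g : ℕ → ℕ) (b : ℕ) → (∀ n → g n ℕ.< b) → ∃₂ λ n m → 1 ℕ.≤ m × g n ≡ g (n ℕ.+ m)
bounded⇒repeats g b g<b
  with i , j , i<j , same ← FinP.pigeonhole (ℕP.n<1+n b) (λ i → Fin.fromℕ< (g<b (Fin.toℕ i)))
  = Fin.toℕ i , Fin.toℕ j ℕ.∸ Fin.toℕ i , ℕP.m<n⇒0<n∸m i<j , (begin
      g (Fin.toℕ i)                                   ≡⟨ FinP.toℕ-fromℕ< (g<b (Fin.toℕ i)) ⟨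
      Fin.toℕ (Fin.fromℕ< (g<b (Fin.toℕ i)))          ≡⟨ cong Fin.toℕ same ⟩
      Fin.toℕ (Fin.fromℕ< (g<b (Fin.toℕ j)))          ≡⟨ FinP.toℕ-fromℕ< (g<b (Fin.toℕ j)) ⟩
      g (Fin.toℕ j)                                   ≡⟨ cong g (ℕP.m+[n∸m]≡n (ℕP.<⇒≤ i<j)) ⟨
      g (Fin.toℕ i ℕ.+ (Fin.toℕ j ℕ.∸ Fin.toℕ i))     ∎)
  where open ≡-Reasoning

private
  fold : ℕ → ℤ → ℕ
  fold b (+ k)    = k
  fold b -[1+ k ] = b ℕ.+ suc k

  fold-< : ∀ b z → ℤ.∣ z ∣ ℕ.≤ b → fold b z ℕ.< suc (b ℕ.+ b)
  fold-< b (+ k)    k≤b = ℕ.s≤s (ℕP.≤-trans k≤b (ℕP.m≤m+n b b))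
  fold-< b -[1+ k ] k<b = ℕ.s≤s (ℕP.+-monoʳ-≤ b k<b)

  fold-injective : ∀ b x y → ℤ.∣ x ∣ ℕ.≤ b → ℤ.∣ y ∣ ℕ.≤ b → fold b x ≡ fold b y → x ≡ y
  fold-injective b (+ k)    (+ l)    _   _   eq = cong +_ eq
  fold-injective b (+ k)    -[1+ l ] k≤b _   eq = ⊥-elim (ℕP.<-irrefl refl
    (ℕP.≤-<-trans (ℕP.≤-trans (ℕP.≤-reflexive (sym eq)) k≤b) (ℕP.m<m+n b ℕ.z<s)))
  fold-injective b -[1+ k ] (+ l)    _   l≤b eq = ⊥-elim (ℕP.<-irrefl refl
    (ℕP.≤-<-trans (ℕP.≤-trans (ℕP.≤-reflexive eq) l≤b) (ℕP.m<m+n b ℕ.z<s)))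
  fold-injective b -[1+ k ] -[1+ l ] _   _   eq = cong (λ n → -[1+ ℕ.pred n ]) (ℕP.+-cancelˡ-≡ b _ _ eq)

∣∣-bounded⇒repeats : (f : ℕ → ℤ) (b : ℕ) → (∀ n → ℤ.∣ f n ∣ ℕ.≤ b) →
                      ∃₂ λ n m → 1 ℕ.≤ m × f n ≡ f (n ℕ.+ m)
∣∣-bounded⇒repeats f b bounded
  with n , m , m≥1 , same ← bounded⇒repeats (λ n → fold b (f n)) (suc (b ℕ.+ b))
                                             (λ n → fold-< b (f n) (bounded n))
  = n , m , m≥1 , fold-injective b (f n) (f (n ℕ.+ m)) (bounded n) (bounded (n ℕ.+ m)) same

module _ (inB : ℕ → Bool) (q : ℕ → ℕ) where

  private
    S : (ℕ → ℕ) → ℕ → ℚ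
    S = partialΔ inB q

  zeroFirst-≤ : ∀ n δ {k} → k ℕ.≤ n → zeroFirst n δ k ≡ 0
  zeroFirst-≤ n δ {k} k≤n with k ℕ.≤ᵇ n | ℕP.≤⇒≤ᵇ k≤n
  ... | true | _ = refl

  zeroFirst-> : ∀ n δ {k} → n ℕ.< k → zeroFirst n δ k ≡ δ k
  zeroFirst-> n δ {k} n<k with k ℕ.≤ᵇ n in k≤ᵇn
  ... | false = refl
  ... | true  = ⊥-elim (ℕP.<⇒≱ n<k (ℕP.≤ᵇ⇒≤ k n (subst T (sym k≤ᵇn) _)))

  term-cong : ∀ δ δ′ k → δ k ≡ δ′ k → term inB q δ k ≡ term inB q δ′ k
  term-cong δ δ′ k eq = cong (λ x → safeDiv (sign inB k ℤ.* + x) (Q q k)) eq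

  term-zero : ∀ δ k → δ k ≡ 0 → term inB q δ k ≡ 0ℚ
  term-zero δ k δₖ≡0 rewrite δₖ≡0 | ℤP.*-zeroʳ (sign inB k) = safeDiv-zero (Q q k)
    where
    safeDiv-zero : ∀ n → safeDiv (+ 0) n ≡ 0ℚ
    safeDiv-zero zero    = refl
    safeDiv-zero (suc n) = 0/n≡0 (suc n)

  partialΔ-zeroFirst-≤ : ∀ n δ N → N ℕ.≤ n → S (zeroFirst n δ) N ≡ 0ℚ
  partialΔ-zeroFirst-≤ n δ zero    _    = refl
  partialΔ-zeroFirst-≤ n δ (suc N) N<n =
    cong₂ _+_ (partialΔ-zeroFirst-≤ n δ N (ℕP.<⇒≤ N<n)) (term-zero (zeroFirst n δ) (suc N) (zeroFirst-≤ n δ N<n))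

  partialΔ-zeroFirst-+ : ∀ n δ j → S (zeroFirst n δ) (n ℕ.+ j) ≡ S δ (n ℕ.+ j) - S δ n
  partialΔ-zeroFirst-+ n δ zero rewrite ℕP.+-identityʳ n =
    trans (partialΔ-zeroFirst-≤ n δ n ℕP.≤-refl) (sym (+-inverseʳ (S δ n)))
  partialΔ-zeroFirst-+ n δ (suc j) rewrite ℕP.+-suc n j = begin
    S (zeroFirst n δ) (n ℕ.+ j) + term inB q (zeroFirst n δ) (suc (n ℕ.+ j))
      ≡⟨ cong₂ _+_ (partialΔ-zeroFirst-+ n δ j)
                   (term-cong (zeroFirst n δ) δ (suc (n ℕ.+ j)) (zeroFirst-> n δ (ℕ.s≤s (ℕP.m≤m+n n j)))) ⟩
    (S δ (n ℕ.+ j) - S δ n) + term inB q δ (suc (n ℕ.+ j))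
      ≡⟨ solve 3 (λ x y t → (x :- y) :+ t := (x :+ t) :- y) refl
               (S δ (n ℕ.+ j)) (S δ n) (term inB q δ (suc (n ℕ.+ j))) ⟩
    (S δ (n ℕ.+ j) + term inB q δ (suc (n ℕ.+ j))) - S δ n ∎
    where
    open ≡-Reasoning
    open ℚ-Solver

  partialΔ-zeroFirst : ∀ n δ N → n ℕ.≤ N → S (zeroFirst n δ) N ≡ S δ N - S δ n
  partialΔ-zeroFirst n δ N n≤N =
    subst (λ k → S (zeroFirst n δ) k ≡ S δ k - S δ n) (ℕP.m+[n∸m]≡n n≤N) (partialΔ-zeroFirst-+ n δ (N ℕ.∸ n))

  partialΔ-zeroFirst-scaled : ∀ δ n j B k → n ℕ.⊔ j ℕ.≤ k →
    S (zeroFirst n δ) k - B * S (zeroFirst j δ) k ≡ (S δ k - S δ n) - B * (S δ k - S δ j)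
  partialΔ-zeroFirst-scaled δ n j B k n⊔j≤k =
    cong₂ (λ x y → x - B * y) (partialΔ-zeroFirst n δ k (ℕP.≤-trans (ℕP.m≤m⊔n n j) n⊔j≤k))
                              (partialΔ-zeroFirst j δ k (ℕP.≤-trans (ℕP.m≤n⊔m n j) n⊔j≤k))

  -- the numerator of Σ_{n<k≤n+j} a_k δ_k / (q_{n+1}⋯q_k) over the denominator q_{n+1}⋯q_{n+j}
  blockNumer : (ℕ → ℕ) → ℕ → ℕ → ℤ
  blockNumer δ n zero    = + 0
  blockNumer δ n (suc j) = blockNumer δ n j ℤ.* + q (n ℕ.+ suc j) ℤ.+ sign inB (n ℕ.+ suc j) ℤ.* + δ (n ℕ.+ suc j)

  Q-+ : ∀ n j → Q q (n ℕ.+ j) ≡ Q q n ℕ.* blockProd q n j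
  Q-+ n zero    rewrite ℕP.+-identityʳ n = sym (ℕP.*-identityʳ (Q q n))
  Q-+ n (suc j) rewrite ℕP.+-suc n j | Q-+ n j = ℕP.*-assoc (Q q n) (blockProd q n j) _

  blockNumer-+ : ∀ δ n j → blockNumer δ 0 (n ℕ.+ j) ≡ blockNumer δ 0 n ℤ.* + blockProd q n j ℤ.+ blockNumer δ n j
  blockNumer-+ δ n zero rewrite ℕP.+-identityʳ n =
    sym (trans (ℤP.+-identityʳ _) (ℤP.*-identityʳ (blockNumer δ 0 n)))
  blockNumer-+ δ n (suc j) = begin
    blockNumer δ 0 (n ℕ.+ suc j)
      ≡⟨ cong (blockNumer δ 0) (ℕP.+-suc n j) ⟩
    blockNumer δ 0 (n ℕ.+ j) ℤ.* + q k ℤ.+ sign inB k ℤ.* + δ k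
      ≡⟨ cong (λ x → x ℤ.* + q k ℤ.+ sign inB k ℤ.* + δ k) (blockNumer-+ δ n j) ⟩
    (W ℤ.* + P ℤ.+ B) ℤ.* + q k ℤ.+ sign inB k ℤ.* + δ k
      ≡⟨ solve 6 (λ W P B qₖ aₖ δₖ → (W :* P :+ B) :* qₖ :+ aₖ :* δₖ := W :* (P :* qₖ) :+ (B :* qₖ :+ aₖ :* δₖ))
               refl W (+ P) B (+ q k) (sign inB k) (+ δ k) ⟩
    W ℤ.* (+ P ℤ.* + q k) ℤ.+ (B ℤ.* + q k ℤ.+ sign inB k ℤ.* + δ k)
      ≡⟨ cong (λ x → W ℤ.* x ℤ.+ (B ℤ.* + q k ℤ.+ sign inB k ℤ.* + δ k)) (ℤP.pos-* P (q k)) ⟨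
    W ℤ.* + (P ℕ.* q k) ℤ.+ (B ℤ.* + q k ℤ.+ sign inB k ℤ.* + δ k)
      ≡⟨ cong (λ i → W ℤ.* + (P ℕ.* q i) ℤ.+ (B ℤ.* + q i ℤ.+ sign inB i ℤ.* + δ i)) (ℕP.+-suc n j) ⟨
    W ℤ.* + blockProd q n (suc j) ℤ.+ blockNumer δ n (suc j) ∎
    where
    open ≡-Reasoning
    open +-*-Solver
    k = suc (n ℕ.+ j)
    W = blockNumer δ 0 n
    P = blockProd q n j
    B = blockNumer δ n j

  ∣blockNumer∣<blockProd : ∀ δ → (∀ k → 1 ℕ.≤ k → δ k ℕ.< q k) → ∀ n j → ℤ.∣ blockNumer δ n j ∣ ℕ.< blockProd q n j
  ∣blockNumer∣<blockProd δ δ<q n zero    = ℕP.≤-refl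
  ∣blockNumer∣<blockProd δ δ<q n (suc j) = begin-strict
    ℤ.∣ B ℤ.* + qₖ ℤ.+ sign inB k ℤ.* + δ k ∣        ≤⟨ ℤP.∣i+j∣≤∣i∣+∣j∣ (B ℤ.* + qₖ) (sign inB k ℤ.* + δ k) ⟩
    ℤ.∣ B ℤ.* + qₖ ∣ ℕ.+ ℤ.∣ sign inB k ℤ.* + δ k ∣  ≡⟨ cong₂ ℕ._+_ (ℤP.abs-* B (+ qₖ)) ∣aₖδₖ∣≡δₖ ⟩
    ℤ.∣ B ∣ ℕ.* qₖ ℕ.+ δ k                           <⟨ ℕP.+-monoʳ-< (ℤ.∣ B ∣ ℕ.* qₖ) (δ<q k k≥1) ⟩
    ℤ.∣ B ∣ ℕ.* qₖ ℕ.+ qₖ                            ≡⟨ ℕP.+-comm (ℤ.∣ B ∣ ℕ.* qₖ) qₖ ⟩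
    suc ℤ.∣ B ∣ ℕ.* qₖ                               ≤⟨ ℕP.*-monoˡ-≤ qₖ (∣blockNumer∣<blockProd δ δ<q n j) ⟩
    blockProd q n j ℕ.* qₖ                           ∎
    where
    open ℕP.≤-Reasoning
    k = n ℕ.+ suc j
    k≥1 = ℕP.≤-trans (ℕ.s≤s ℕ.z≤n) (ℕP.m≤n+m (suc j) n)
    qₖ = q k
    B = blockNumer δ n j
    ∣aₖδₖ∣≡δₖ : ℤ.∣ sign inB k ℤ.* + δ k ∣ ≡ δ k
    ∣aₖδₖ∣≡δₖ = trans (ℤP.abs-* (sign inB k) (+ δ k)) (trans (cong (ℕ._* δ k) ∣sign∣≡1) (ℕP.*-identityˡ (δ k)))
      where
      ∣sign∣≡1 : ℤ.∣ sign inB k ∣ ≡ 1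
      ∣sign∣≡1 with inB k
      ... | true  = refl
      ... | false = refl

  ΔEqScaled-if-remainders-proportional : ∀ δ {r} → ConvergesTo (S δ) r → ∀ n j B →
    r - S δ n ≡ B * (r - S δ j) → ΔEqScaled inB q (zeroFirst n δ) B (zeroFirst j δ)
  ΔEqScaled-if-remainders-proportional δ {r} conv n j B proportional =
    ConvergesTo-rescale (S δ) r (λ k → S (zeroFirst n δ) k - B * S (zeroFirst j δ) k) 0ℚ (1ℚ - B)
                        (n ℕ.⊔ j , related) conv
    where
    related : ∀ k → n ℕ.⊔ j ℕ.≤ k → S (zeroFirst n δ) k - B * S (zeroFirst j δ) k - 0ℚ ≡ (1ℚ - B) * (S δ k - r)
    related k n⊔j≤k = begin
      S (zeroFirst n δ) k - B * S (zeroFirst j δ) k - 0ℚ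
        ≡⟨ cong (_- 0ℚ) (partialΔ-zeroFirst-scaled δ n j B k n⊔j≤k) ⟩
      (S δ k - S δ n) - B * (S δ k - S δ j) - 0ℚ
        ≡⟨ solve 5 (λ s sₙ sⱼ B r → (s :- sₙ) :- B :* (s :- sⱼ) :- con 0ℚ
                                   := (con 1ℚ :- B) :* (s :- r) :+ ((r :- sₙ) :- B :* (r :- sⱼ)))
                 refl (S δ k) (S δ n) (S δ j) B r ⟩
      (1ℚ - B) * (S δ k - r) + ((r - S δ n) - B * (r - S δ j))
        ≡⟨ cong (λ x → (1ℚ - B) * (S δ k - r) + (x - B * (r - S δ j))) proportional ⟩
      (1ℚ - B) * (S δ k - r) + (B * (r - S δ j) - B * (r - S δ j))
        ≡⟨ solve 2 (λ x y → x :+ (y :- y) := x) refl ((1ℚ - B) * (S δ k - r)) (B * (r - S δ j)) ⟩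
      (1ℚ - B) * (S δ k - r) ∎
      where
      open ≡-Reasoning
      open ℚ-Solver

  ΔRational-if-ΔEqScaled : ∀ δ n j B → B ≢ 1ℚ →
    ΔEqScaled inB q (zeroFirst n δ) B (zeroFirst j δ) → ΔRational inB q δ
  ΔRational-if-ΔEqScaled δ n j B B≢1 scaled =
    r , ConvergesTo-rescale (λ k → S (zeroFirst n δ) k - B * S (zeroFirst j δ) k) 0ℚ (S δ) r c
                            (n ℕ.⊔ j , related) scaled
    where
    open ℚ-Solver
    instance
      1-B-nonZero : NonZero (1ℚ - B)
      1-B-nonZero = ≢-nonZero {1ℚ - B} λ 1-B≡0 → B≢1 (begin
        B              ≡⟨ solve 1 (λ B → B := con 1ℚ :- (con 1ℚ :- B)) refl B ⟩
        1ℚ - (1ℚ - B)  ≡⟨ cong (λ x → 1ℚ - x) 1-B≡0 ⟩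
        1ℚ - 0ℚ        ≡⟨ +-identityʳ 1ℚ ⟩
        1ℚ             ∎)
        where open ≡-Reasoning
    c r : ℚ
    c = 1/ (1ℚ - B)
    r = c * (S δ n - B * S δ j)
    related : ∀ k → n ℕ.⊔ j ℕ.≤ k →
              S δ k - r ≡ c * (S (zeroFirst n δ) k - B * S (zeroFirst j δ) k - 0ℚ)
    related k n⊔j≤k = begin
      S δ k - c * (S δ n - B * S δ j)
        ≡⟨ solve 5 (λ s sₙ sⱼ B c → s :- c :* (sₙ :- B :* sⱼ)
                                   := c :* ((s :- sₙ) :- B :* (s :- sⱼ) :- con 0ℚ)
                                      :+ s :* (con 1ℚ :- c :* (con 1ℚ :- B)))
                 refl (S δ k) (S δ n) (S δ j) B c ⟩
      c * ((S δ k - S δ n) - B * (S δ k - S δ j) - 0ℚ) + S δ k * (1ℚ - c * (1ℚ - B))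
        ≡⟨ cong (λ x → c * ((S δ k - S δ n) - B * (S δ k - S δ j) - 0ℚ) + S δ k * (1ℚ - x)) (*-inverseˡ (1ℚ - B)) ⟩
      c * ((S δ k - S δ n) - B * (S δ k - S δ j) - 0ℚ) + S δ k * (1ℚ - 1ℚ)
        ≡⟨ solve 2 (λ x s → x :+ s :* (con 1ℚ :- con 1ℚ) := x) refl
                 (c * ((S δ k - S δ n) - B * (S δ k - S δ j) - 0ℚ)) (S δ k) ⟩
      c * ((S δ k - S δ n) - B * (S δ k - S δ j) - 0ℚ)
        ≡⟨ cong (λ x → c * (x - 0ℚ)) (partialΔ-zeroFirst-scaled δ n j B k n⊔j≤k) ⟨
      c * (S (zeroFirst n δ) k - B * S (zeroFirst j δ) k - 0ℚ) ∎
      where open ≡-Reasoning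

  module _ (q-pos : ∀ k → 1 ℕ.≤ k → 1 ℕ.≤ q k) where

    Q-pos : ∀ k → 1 ℕ.≤ Q q k
    Q-pos zero    = ℕP.≤-refl
    Q-pos (suc k) = ℕP.*-mono-≤ (Q-pos k) (q-pos (suc k) (ℕ.s≤s ℕ.z≤n))

    partialΔ-*-Q : ∀ δ N → S δ N * fromℕ (Q q N) ≡ fromℤ (blockNumer δ 0 N)
    partialΔ-*-Q δ zero    = refl
    partialΔ-*-Q δ (suc N) = begin
      (S δ N + t) * fromℕ (Q q N ℕ.* q k)
        ≡⟨ cong ((S δ N + t) *_) (fromℕ-* (Q q N) (q k)) ⟩
      (S δ N + t) * (A * qₖ)
        ≡⟨ solve 4 (λ s t A qₖ → (s :+ t) :* (A :* qₖ) := s :* A :* qₖ :+ t :* (A :* qₖ)) refl (S δ N) t A qₖ ⟩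
      S δ N * A * qₖ + t * (A * qₖ)
        ≡⟨ cong₂ (λ x y → x * qₖ + y) (partialΔ-*-Q δ N) t*Qₖ≡aₖδₖ ⟩
      fromℤ (blockNumer δ 0 N) * qₖ + fromℤ (sign inB k ℤ.* + δ k)
        ≡⟨ cong (_+ fromℤ (sign inB k ℤ.* + δ k)) (fromℤ-* (blockNumer δ 0 N) (+ q k)) ⟨
      fromℤ (blockNumer δ 0 N ℤ.* + q k) + fromℤ (sign inB k ℤ.* + δ k)
        ≡⟨ fromℤ-+ (blockNumer δ 0 N ℤ.* + q k) (sign inB k ℤ.* + δ k) ⟨
      fromℤ (blockNumer δ 0 (suc N)) ∎
      where
      open ≡-Reasoning
      open ℚ-Solver
      k = suc N
      t = term inB q δ k
      A = fromℕ (Q q N)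
      qₖ = fromℕ (q k)
      t*Qₖ≡aₖδₖ : t * (A * qₖ) ≡ fromℤ (sign inB k ℤ.* + δ k)
      t*Qₖ≡aₖδₖ = trans (cong (t *_) (sym (fromℕ-* (Q q N) (q k)))) (safeDiv-*-fromℕ _ (Q-pos k))

    partialΔ-block-*-Q : ∀ δ n j →
      (S δ (n ℕ.+ j) - S δ n) * fromℕ (Q q n) * fromℕ (blockProd q n j) ≡ fromℤ (blockNumer δ n j)
    partialΔ-block-*-Q δ n j = begin
      (S δ (n ℕ.+ j) - S δ n) * A * P
        ≡⟨ solve 4 (λ s′ s A P → (s′ :- s) :* A :* P := s′ :* (A :* P) :- s :* A :* P)
                 refl (S δ (n ℕ.+ j)) (S δ n) A P ⟩
      S δ (n ℕ.+ j) * (A * P) - S δ n * A * P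
        ≡⟨ cong₂ (λ x y → x - y * P) Sₙ₊ⱼ*Qₙ₊ⱼ (partialΔ-*-Q δ n) ⟩
      fromℤ (blockNumer δ 0 (n ℕ.+ j)) - fromℤ W * P
        ≡⟨ cong₂ _-_ (cong fromℤ (blockNumer-+ δ n j)) (sym (fromℤ-* W (+ blockProd q n j))) ⟩
      fromℤ (W ℤ.* + blockProd q n j ℤ.+ B) - fromℤ (W ℤ.* + blockProd q n j)
        ≡⟨ cong (_- fromℤ (W ℤ.* + blockProd q n j)) (fromℤ-+ (W ℤ.* + blockProd q n j) B) ⟩
      fromℤ (W ℤ.* + blockProd q n j) + fromℤ B - fromℤ (W ℤ.* + blockProd q n j)
        ≡⟨ solve 2 (λ x y → x :+ y :- x := y) refl (fromℤ (W ℤ.* + blockProd q n j)) (fromℤ B) ⟩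
      fromℤ B ∎
      where
      open ≡-Reasoning
      open ℚ-Solver
      A = fromℕ (Q q n)
      P = fromℕ (blockProd q n j)
      W = blockNumer δ 0 n
      B = blockNumer δ n j
      Sₙ₊ⱼ*Qₙ₊ⱼ : S δ (n ℕ.+ j) * (A * P) ≡ fromℤ (blockNumer δ 0 (n ℕ.+ j))
      Sₙ₊ⱼ*Qₙ₊ⱼ = trans (cong (λ x → S δ (n ℕ.+ j) * x) (trans (sym (fromℕ-* (Q q n) (blockProd q n j)))
                                                                 (cong fromℕ (sym (Q-+ n j)))))
                        (partialΔ-*-Q δ (n ℕ.+ j))

    partialΔ-block-bound : ∀ δ → (∀ k → 1 ℕ.≤ k → δ k ℕ.< q k) →
                           ∀ n j → ∣ S δ (n ℕ.+ j) - S δ n ∣ * fromℕ (Q q n) < 1ℚ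
    partialΔ-block-bound δ δ<q n j = *-cancelʳ-<-nonNeg P {{fromℕ-nonNeg (blockProd q n j)}} (begin-strict
      ∣ x ∣ * A * P      ≡⟨ cong (_* P) (∣-∣-*-fromℕ x (Q q n)) ⟨
      ∣ x * A ∣ * P      ≡⟨ ∣-∣-*-fromℕ (x * A) (blockProd q n j) ⟨
      ∣ x * A * P ∣      ≡⟨ cong ∣_∣ (partialΔ-block-*-Q δ n j) ⟩
      ∣ fromℤ B ∣        ≡⟨ fromℤ-∣-∣ B ⟩
      fromℕ ℤ.∣ B ∣      <⟨ fromℤ-mono-< (ℤ.+<+ (∣blockNumer∣<blockProd δ δ<q n j)) ⟩
      P                  ≡⟨ *-identityˡ P ⟨
      1ℚ * P             ∎)
      where
      open ≤-Reasoning
      x = S δ (n ℕ.+ j) - S δ n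
      A = fromℕ (Q q n)
      P = fromℕ (blockProd q n j)
      B = blockNumer δ n j

    module _ (δ : ℕ → ℕ) (δ<q : ∀ k → 1 ℕ.≤ k → δ k ℕ.< q k) (r : ℚ) (conv : ConvergesTo (S δ) r) where

      private
        D-pos : Positive (fromℕ (↧ₙ r))
        D-pos = fromℕ-pos {↧ₙ r} (ℕ.s≤s ℕ.z≤n)

      -- d Qₙ (r - Sₙ), where r = ↥ r / d; an integer because Qₙ Sₙ is one
      scaledRemainder : ℕ → ℤ
      scaledRemainder n = ↥ r ℤ.* + Q q n ℤ.- + ↧ₙ r ℤ.* blockNumer δ 0 n

      fromℤ-scaledRemainder : ∀ n → fromℤ (scaledRemainder n) ≡ (r - S δ n) * fromℕ (Q q n ℕ.* ↧ₙ r)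
      fromℤ-scaledRemainder n = begin
        fromℤ (↥ r ℤ.* + Q q n ℤ.- + ↧ₙ r ℤ.* blockNumer δ 0 n)
          ≡⟨ fromℤ-- (↥ r ℤ.* + Q q n) (+ ↧ₙ r ℤ.* blockNumer δ 0 n) ⟩
        fromℤ (↥ r ℤ.* + Q q n) - fromℤ (+ ↧ₙ r ℤ.* blockNumer δ 0 n)
          ≡⟨ cong₂ _-_ (fromℤ-* (↥ r) (+ Q q n)) (fromℤ-* (+ ↧ₙ r) (blockNumer δ 0 n)) ⟩
        fromℤ (↥ r) * A - D * fromℤ (blockNumer δ 0 n)
          ≡⟨ cong₂ (λ x y → x * A - D * y) r*D≡↥r (partialΔ-*-Q δ n) ⟨
        r * D * A - D * (S δ n * A)
          ≡⟨ solve 4 (λ r s A D → r :* D :* A :- D :* (s :* A) := (r :- s) :* (A :* D)) refl r (S δ n) A D ⟩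
        (r - S δ n) * (A * D)
          ≡⟨ cong ((r - S δ n) *_) (fromℕ-* (Q q n) (↧ₙ r)) ⟨
        (r - S δ n) * fromℕ (Q q n ℕ.* ↧ₙ r) ∎
        where
        open ≡-Reasoning
        open ℚ-Solver
        A = fromℕ (Q q n)
        D = fromℕ (↧ₙ r)
        r*D≡↥r : r * D ≡ fromℤ (↥ r)
        r*D≡↥r = trans (cong (_* D) (sym (↥p/↧p≡p r))) (/-*-fromℕ (↥ r) _)

      ∣scaledRemainder∣≤↧r : ∀ n → ℤ.∣ scaledRemainder n ∣ ℕ.≤ ↧ₙ r
      ∣scaledRemainder∣≤↧r n = bound (ConvergesTo-*-bound {S δ} {r} conv C {{fromℕ-nonNeg Qₙd}} 1ℚ (positive⁻¹ 1ℚ))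
        where
        open ≤-Reasoning
        open ℚ-Solver
        Qₙd = Q q n ℕ.* ↧ₙ r
        A = fromℕ (Q q n)
        D = fromℕ (↧ₙ r)
        C = fromℕ Qₙd
        bound : (∃ λ K → ∀ k → K ℕ.≤ k → ∣ S δ k - r ∣ * C < 1ℚ) → ℤ.∣ scaledRemainder n ∣ ℕ.≤ ↧ₙ r
        bound (K , close) = ℕP.m<1+n⇒m≤n (ℤP.drop‿+<+ (fromℤ-cancel-< (begin-strict
          fromℕ ℤ.∣ scaledRemainder n ∣                 ≡⟨ fromℤ-∣-∣ (scaledRemainder n) ⟨
          ∣ fromℤ (scaledRemainder n) ∣                 ≡⟨ cong ∣_∣ (fromℤ-scaledRemainder n) ⟩
          ∣ (r - S δ n) * C ∣                           ≡⟨ cong ∣_∣ (solve 4 (λ r s s′ C → (r :- s) :* C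
                                                                                 := (s′ :- s) :* C :- (s′ :- r) :* C)
                                                                         refl r (S δ n) (S δ N) C) ⟩
          ∣ (S δ N - S δ n) * C - (S δ N - r) * C ∣     ≤⟨ ∣p-q∣≤∣p∣+∣q∣ ((S δ N - S δ n) * C) ((S δ N - r) * C) ⟩
          ∣ (S δ N - S δ n) * C ∣ + ∣ (S δ N - r) * C ∣ ≡⟨ cong₂ _+_ (∣-∣-*-fromℕ (S δ N - S δ n) Qₙd)
                                                                     (∣-∣-*-fromℕ (S δ N - r) Qₙd) ⟩
          ∣ S δ N - S δ n ∣ * C + ∣ S δ N - r ∣ * C     <⟨ +-mono-< blockPart (close N (ℕP.m≤n+m K n)) ⟩
          D + 1ℚ                                         ≡⟨ fromℕ-+ (↧ₙ r) 1 ⟨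
          fromℕ (↧ₙ r ℕ.+ 1)                             ≡⟨ cong fromℕ (ℕP.+-comm (↧ₙ r) 1) ⟩
          fromℕ (suc (↧ₙ r))                             ∎)))
          where
          N = n ℕ.+ K
          blockPart : ∣ S δ N - S δ n ∣ * C < D
          blockPart = begin-strict
            ∣ S δ N - S δ n ∣ * C         ≡⟨ cong (∣ S δ N - S δ n ∣ *_) (fromℕ-* (Q q n) (↧ₙ r)) ⟩
            ∣ S δ N - S δ n ∣ * (A * D)   ≡⟨ *-assoc ∣ S δ N - S δ n ∣ A D ⟨
            ∣ S δ N - S δ n ∣ * A * D     <⟨ *-monoˡ-<-pos D {{D-pos}} (partialΔ-block-bound δ δ<q n K) ⟩
            1ℚ * D                        ≡⟨ *-identityˡ D ⟩
            D                             ∎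

      scaledRemainder-≡⇒proportional : ∀ n m → scaledRemainder n ≡ scaledRemainder (n ℕ.+ m) →
                                       r - S δ n ≡ fromℕ (blockProd q n m) * (r - S δ (n ℕ.+ m))
      scaledRemainder-≡⇒proportional n m same = *-cancelʳ-≡-pos (A * D) {{A*D-pos}} (begin
        (r - S δ n) * (A * D)            ≡⟨ cong ((r - S δ n) *_) (fromℕ-* (Q q n) (↧ₙ r)) ⟨
        (r - S δ n) * fromℕ (Q q n ℕ.* ↧ₙ r)
          ≡⟨ trans (sym (fromℤ-scaledRemainder n)) (trans (cong fromℤ same) (fromℤ-scaledRemainder j)) ⟩
        (r - S δ j) * fromℕ (Q q j ℕ.* ↧ₙ r)
          ≡⟨ cong ((r - S δ j) *_) (trans (fromℕ-* (Q q j) (↧ₙ r)) (cong (_* D) Aⱼ≡A*P)) ⟩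
        (r - S δ j) * (A * P * D)
          ≡⟨ solve 4 (λ x A P D → x :* (A :* P :* D) := P :* x :* (A :* D)) refl (r - S δ j) A P D ⟩
        P * (r - S δ j) * (A * D)        ∎)
        where
        open ≡-Reasoning
        open ℚ-Solver
        j = n ℕ.+ m
        A = fromℕ (Q q n)
        D = fromℕ (↧ₙ r)
        P = fromℕ (blockProd q n m)
        Aⱼ≡A*P : fromℕ (Q q j) ≡ A * P
        Aⱼ≡A*P = trans (cong fromℕ (Q-+ n m)) (fromℕ-* (Q q n) (blockProd q n m))
        A*D-pos : Positive (A * D)
        A*D-pos = pos*pos⇒pos A {{fromℕ-pos (Q-pos n)}} D {{D-pos}}

      remainders-proportional : ∃₂ λ n m → 1 ℕ.≤ m × r - S δ n ≡ fromℕ (blockProd q n m) * (r - S δ (n ℕ.+ m))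
      remainders-proportional =
        map₂ (λ {n} → map₂ (λ {m} → map₂ (scaledRemainder-≡⇒proportional n m)))
             (∣∣-bounded⇒repeats scaledRemainder (↧ₙ r) ∣scaledRemainder∣≤↧r)

      tails-scaled : ∃₂ λ n m → 1 ℕ.≤ m ×
        ΔEqScaled inB q (zeroFirst n δ) (fromℕ (blockProd q n m)) (zeroFirst (n ℕ.+ m) δ)
      tails-scaled = map₂ (λ {n} → map₂ (λ {m} → map₂
        (ΔEqScaled-if-remainders-proportional δ conv n (n ℕ.+ m) (fromℕ (blockProd q n m)))))
        remainders-proportional

blockProd-≥2 : ∀ q → (∀ k → 1 ℕ.≤ k → 2 ℕ.≤ q k) → ∀ n m → 1 ℕ.≤ m → 2 ℕ.≤ blockProd q n m
blockProd-≥2 q q≥2 n (suc m) _ = ℕP.*-mono-≤ (blockProd-pos m) (q≥2 (n ℕ.+ suc m) (1≤n+suc m))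
  where
  1≤n+suc : ∀ m → 1 ℕ.≤ n ℕ.+ suc m
  1≤n+suc m = ℕP.≤-trans (ℕ.s≤s ℕ.z≤n) (ℕP.m≤n+m (suc m) n)
  blockProd-pos : ∀ m → 1 ℕ.≤ blockProd q n m
  blockProd-pos zero    = ℕP.≤-refl
  blockProd-pos (suc m) = ℕP.*-mono-≤ (blockProd-pos m) (ℕP.≤-trans (ℕP.n≤1+n 1) (q≥2 (n ℕ.+ suc m) (1≤n+suc m)))

mainTheorem3 : (inB : ℕ → Bool) (q : ℕ → ℕ) (ε : ℕ → ℕ)
    → (∀ k → 1 ℕ.≤ k → 2 ℕ.≤ q k)
    → (∀ k → 1 ℕ.≤ k → ε k ℕ.< q k)
    → ΔRational inB q ε
      ⇔ ∃₂ λ (n m : ℕ) → 1 ℕ.≤ m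
          × ΔEqScaled inB q (zeroFirst n ε) (+ blockProd q n m / 1) (zeroFirst (n ℕ.+ m) ε)
mainTheorem3 inB q ε q≥2 ε<q = mk⇔
  (λ (r , conv) → tails-scaled inB q q-pos ε ε<q r conv)
  (λ (n , m , m≥1 , scaled) →
     ΔRational-if-ΔEqScaled inB q ε n (n ℕ.+ m) (fromℕ (blockProd q n m)) (P≢1 n m m≥1) scaled)
  where
  q-pos : ∀ k → 1 ℕ.≤ k → 1 ℕ.≤ q k
  q-pos k k≥1 = ℕP.≤-trans (ℕP.n≤1+n 1) (q≥2 k k≥1)

  P≢1 : ∀ n m → 1 ℕ.≤ m → fromℕ (blockProd q n m) ≢ 1ℚ
  P≢1 n m m≥1 P≡1 = <⇒≢ (fromℤ-mono-< (ℤ.+<+ (blockProd-≥2 q q≥2 n m m≥1))) (sym P≡1)
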